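{- Let $\mathcal I$ be an N$^4$ interpretation of $\mathcal L$, $\mathcal V$ a variable assignment with respect to $\mathcal I$, and $F$ a formula of $\mathcal L$ in prefix negation form such that $F\neq\neg^{2k+1}G$ for every $k\in\mathbb N$ and every formula $G$. Then $\mathit{val}_{\mathcal I,\mathcal V}(F)\neq\mathit{val}_{\mathcal I,\mathcal V}(\neg F)$.
   Context: Fix a first-order language $\mathcal L$ with a non-empty set of constants, function symbols, predicate symbols of arities $n\ge 0$, the falsum $\bot$ (which is not an atom), connectives $\neg,\wedge,\vee$ and quantifiers $\forall,\exists$. $\neg^n$ denotes $n$-fold negation, $\top:=\neg\bot$. A formula $F$ is in prefix negation form if $F=\neg^nG$ for some $n\ge0$ and some formula $G$ in which $\neg$ does not occur. An N$^4$ interpretation $\mathcal I=(D,\mathit{val})$ of $\mathcal L$ consists of a non-empty set $D$ and an assignment with $\mathit{val}(c)\in D$ for each constant $c$; $\mathit{val}(f):D^n\to D$ for each $n$-ary function symbol $f$; for each $0$-ary predicate symbol $p$, truth values $\mathit{val}(p),\mathit{val}(\neg^2 p)\in\{\mathbf{true},\mathbf{false}\}$ such that $\mathit{val}(p)=\mathbf{true}$ implies $\mathit{val}(\neg^2p)=\mathbf{true}$; for each $n$-ary predicate symbol $p$ ($n\ge1$), relations $\mathit{val}(p)\subseteq\mathit{val}(\neg^2 p)\subseteq D^n$. Variable assignments $\mathcal V$, $\mathcal V[d/x]$, and term values $\mathit{val}_{\mathcal I,\mathcal V}(t)$ are as in classical logic. Write $p(\bar t)$ for either a $0$-ary $p$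 or $p(t_1,\dots,t_n)$, and say $p(\bar t)$ "holds in" $R$ if $R=\mathbf{true}$ (for $0$-ary $p$) or the tuple of values of $t_1,\dots,t_n$ lies in $R$. The valuation $\mathit{val}_{\mathcal I,\mathcal V}$ of formulas is given by: (1.1) $p(\bar t)$ is true iff it holds in $\mathit{val}(p)$; (1.2) $(F_1\wedge F_2)$ true iff both true; (1.3) $(F_1\vee F_2)$ true iff some $F_i$ true; (1.4) $\forall xF$ true iff $\mathit{val}_{\mathcal I,\mathcal V[d/x]}(F)=\mathbf{true}$ for all $d\in D$; (1.5) $\exists xF$ true iff so for some $d$; (2.1) $\neg\bot$ is true, and $\neg p(\bar t)$ is true iff $p(\bar t)$ is not true; (2.2) $\neg(F_1\wedge F_2)$ has the value of $(\neg F_1\vee\neg F_2)$; (2.3) $\neg(F_1\vee F_2)$ that of $(\neg F_1\wedge\neg F_2)$; (2.4) $\neg\forall xF$ that of $\exists x\neg F$; (2.5) $\neg\exists xF$ that of $\forall x\neg F$; (3.1) $\neg^2p(\bar t)$ true iff it holds in $\mathit{val}(\neg^2p)$; (3.2) $\neg^2(F_1\wedge F_2)$ has the value of $(\neg^2F_1\wedge\neg^2F_2)$; (3.3) $\neg^2(F_1\vee F_2)$ that of $(\neg^2F_1\vee\neg^2F_2)$; (3.4) $\neg^2\forall xF$ that of $\forall x\neg^2F$; (3.5) $\neg^2\exists xF$ that of $\exists x\neg^2F$; (4) for every formula $F$, $\neg^3F$ is true iff $\neg^2F$ is not true; (5) a formula is $\mathbf{false}$ iff it is not made true by the clauses above.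 -}

module Defs where

open import Data.Nat using (ℕ; zero; suc; _≟_)
open import Data.Vec using (Vec; []; _∷_)
open import Data.Product using (Σ; ∃; _×_; _,_)
open import Data.Sum using (_⊎_)
open import Data.Empty renaming (⊥ to Empty)
open import Data.Unit using (⊤)
open import Relation.Nullary using (¬_; yes; no)
open import Relation.Binary.PropositionalEquality using (_≡_)

Var : Set
Var = ℕ

record Signature : Set₁ where
  field
    Const  : Set
    const₀ : Const
    Fun    : ℕ → Set
    Pred   : ℕ → Set
open Signature public

module _ (L : Signature) where

  data Term : Set where
    var   : Var → Term
    const : Const L → Term
    app   : ∀ {n} → Fun L n → Vec Term n → Term

  data Formula : Set where
    atom : ∀ {n} → Pred L n → Vec Term n → Formula
    ⊥'   : Formula
    ¬'_  : Formula → Formula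
    _∧'_ : Formula → Formula → Formula
    _∨'_ : Formula → Formula → Formula
    ∀'   : Var → Formula → Formula
    ∃'   : Var → Formula → Formula

negs : {L : Signature} → ℕ → Formula L → Formula L
negs zero    G = G
negs (suc n) G = ¬' (negs n G)

data NegFree {L : Signature} : Formula L → Set where
  nf-atom : ∀ {n} (p : Pred L n) (ts : Vec (Term L) n) → NegFree (atom p ts)
  nf-⊥    : NegFree ⊥'
  nf-∧    : ∀ {A B} → NegFree A → NegFree B → NegFree (A ∧' B)
  nf-∨    : ∀ {A B} → NegFree A → NegFree B → NegFree (A ∨' B)
  nf-∀    : ∀ {x A} → NegFree A → NegFree (∀' x A)
  nf-∃    : ∀ {x A} → NegFree A → NegFree (∃' x A)

PrefixNegForm : {L : Signature} → Formula L → Set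
PrefixNegForm {L} F = Σ ℕ λ n → Σ (Formula L) λ G → NegFree G × F ≡ negs n G

-- N⁴ interpretation. Truth values are propositions (Set); "true" = inhabited.
-- valP p is val(p), valP2 p is val(¬²p); 0-ary predicates get relations on D⁰.
record N4Interp (L : Signature) : Set₁ where
  field
    D      : Set
    d₀     : D
    valC   : Const L → D
    valF   : ∀ {n} → Fun L n → Vec D n → D
    valP   : ∀ {n} → Pred L n → Vec D n → Set
    valP2  : ∀ {n} → Pred L n → Vec D n → Set
    valP⊆valP2 : ∀ {n} (p : Pred L n) (ds : Vec D n) → valP p ds → valP2 p ds
open N4Interp public

module _ {L : Signature} (I : N4Interp L) where

  Assign : Set
  Assign = Var → D I

  _[_/_] : Assign → D I → Var → Assign
  (V [ d / x ]) y with y ≟ x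
  ... | yes _ = d
  ... | no  _ = V y

  mutual
    evalT : Assign → Term L → D I
    evalT V (var x)    = V x
    evalT V (const c)  = valC I c
    evalT V (app f ts) = valF I f (evalTs V ts)

    evalTs : ∀ {n} → Assign → Vec (Term L) n → Vec (D I) n
    evalTs V []       = []
    evalTs V (t ∷ ts) = evalT V t ∷ evalTs V ts

  -- T n F V : "¬ⁿ F is true under I, V", following clauses (1)-(5).
  T : ℕ → Formula L → Assign → Set
  -- (4): ¬³F true iff ¬²F not true (applied to ¬ⁿF, n ≥ 0)
  T (suc (suc (suc n))) F V = ¬ T (suc (suc n)) F V
  T zero (atom p ts) V = valP I p (evalTs V ts)
  T zero ⊥'          V = Empty
  T zero (¬' F)      V = T 1 F V
  T zero (A ∧' B)    V = T zero A V × T zero B V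
  T zero (A ∨' B)    V = T zero A V ⊎ T zero B V
  T zero (∀' x F)    V = (d : D I) → T zero F (V [ d / x ])
  T zero (∃' x F)    V = Σ (D I) λ d → T zero F (V [ d / x ])
  T 1 (atom p ts) V = ¬ valP I p (evalTs V ts)
  T 1 ⊥'          V = ⊤
  T 1 (¬' F)      V = T 2 F V
  T 1 (A ∧' B)    V = T 1 A V ⊎ T 1 B V
  T 1 (A ∨' B)    V = T 1 A V × T 1 B V
  T 1 (∀' x F)    V = Σ (D I) λ d → T 1 F (V [ d / x ])
  T 1 (∃' x F)    V = (d : D I) → T 1 F (V [ d / x ])
  -- (3.x); ¬²⊥ is covered by no clause, hence false by (5)
  T 2 (atom p ts) V = valP2 I p (evalTs V ts)
  T 2 ⊥'          V = Empty
  T 2 (¬' F)      V = T 3 F V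
  T 2 (A ∧' B)    V = T 2 A V × T 2 B V
  T 2 (A ∨' B)    V = T 2 A V ⊎ T 2 B V
  T 2 (∀' x F)    V = (d : D I) → T 2 F (V [ d / x ])
  T 2 (∃' x F)    V = Σ (D I) λ d → T 2 F (V [ d / x ])

  Val : Assign → Formula L → Set
  Val V F = T zero F V

{-# OPTIONS --safe #-}
-- Write F = ¬ⁿG with G negation-free; the hypothesis excludes exactly n = 1.
-- For n = 0, clauses (2.x) are the De Morgan duals of (1.x), so on a
-- negation-free formula ¬G is true precisely when G is not (one direction
-- needs excluded middle).  For n ≥ 2, clause (4) makes ¬ⁿ⁺¹G the plain
-- negation of ¬ⁿG.  Either way val(¬F) is the negation of val(F), and no
-- proposition is equivalent to its own negation.
module Submission where

open import Defs
open import Data.Nat using (ℕ; zero; suc; _*_)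
open import Data.Product using (_,_)
open import Data.Sum using (inj₁; inj₂)
open import Data.Unit using (tt)
open import Function using (_∘_)
open import Function.Bundles using (_⇔_; mk⇔; Equivalence)
open import Function.Construct.Composition using (_⇔-∘_)
open import Function.Construct.Identity using (⇔-id)
open import Level using (0ℓ)
open import Axiom.ExcludedMiddle using (ExcludedMiddle)
open import Axiom.DoubleNegationElimination
  using (DoubleNegationElimination; em⇒dne)
open import Relation.Nullary using (¬_)
open import Relation.Binary.PropositionalEquality using (_≢_; refl)

¬[P⇔¬P] : ∀ {P : Set} → ¬ (P ⇔ (¬ P))
¬[P⇔¬P] P⇔¬P = ¬p (Equivalence.from P⇔¬P ¬p)
  where ¬p = λ p → Equivalence.to P⇔¬P p p

module _ {L : Signature} (I : N4Interp L) where

  negFree-T₁⇒¬T₀ : ∀ {G} → NegFree G → ∀ V → T I 1 G V → ¬ T I 0 G V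
  negFree-T₁⇒¬T₀ (nf-atom p ts) V ¬a      a        = ¬a a
  negFree-T₁⇒¬T₀ nf-⊥           V _       ()
  negFree-T₁⇒¬T₀ (nf-∧ A _)     V (inj₁ a) (x , _) = negFree-T₁⇒¬T₀ A V a x
  negFree-T₁⇒¬T₀ (nf-∧ _ B)     V (inj₂ b) (_ , y) = negFree-T₁⇒¬T₀ B V b y
  negFree-T₁⇒¬T₀ (nf-∨ A _)     V (a , _) (inj₁ x) = negFree-T₁⇒¬T₀ A V a x
  negFree-T₁⇒¬T₀ (nf-∨ _ B)     V (_ , b) (inj₂ y) = negFree-T₁⇒¬T₀ B V b y
  negFree-T₁⇒¬T₀ (nf-∀ A)       V (d , a) f        = negFree-T₁⇒¬T₀ A _ a (f d)
  negFree-T₁⇒¬T₀ (nf-∃ A)       V f       (d , x)  = negFree-T₁⇒¬T₀ A _ (f d) x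

  negFree-¬T₀⇒T₁ : DoubleNegationElimination 0ℓ →
                   ∀ {G} → NegFree G → ∀ V → ¬ T I 0 G V → T I 1 G V
  negFree-¬T₀⇒T₁ dne (nf-atom p ts) V ¬a = ¬a
  negFree-¬T₀⇒T₁ dne nf-⊥           V _  = tt
  negFree-¬T₀⇒T₁ dne (nf-∧ A B)     V ¬ab = dne λ ¬t →
    ¬ab ( dne (¬t ∘ inj₁ ∘ negFree-¬T₀⇒T₁ dne A V)
        , dne (¬t ∘ inj₂ ∘ negFree-¬T₀⇒T₁ dne B V))
  negFree-¬T₀⇒T₁ dne (nf-∨ A B)     V ¬ab =
      negFree-¬T₀⇒T₁ dne A V (¬ab ∘ inj₁)
    , negFree-¬T₀⇒T₁ dne B V (¬ab ∘ inj₂)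
  negFree-¬T₀⇒T₁ dne (nf-∀ A)       V ¬∀ = dne λ ¬t →
    ¬∀ λ d → dne (¬t ∘ (d ,_) ∘ negFree-¬T₀⇒T₁ dne A _)
  negFree-¬T₀⇒T₁ dne (nf-∃ A)       V ¬∃ = λ d →
    negFree-¬T₀⇒T₁ dne A _ (¬∃ ∘ (d ,_))

  T₁-negs⇔¬T₀-negs : DoubleNegationElimination 0ℓ →
                     ∀ {n G} → NegFree G → n ≢ 1 → ∀ V →
                     T I 1 (negs n G) V ⇔ (¬ T I 0 (negs n G) V)
  T₁-negs⇔¬T₀-negs dne {zero} G-negFree _ V =
    mk⇔ (negFree-T₁⇒¬T₀ G-negFree V) (negFree-¬T₀⇒T₁ dne G-negFree V)
  T₁-negs⇔¬T₀-negs dne {suc zero} _ n≢1 V with () ← n≢1 refl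
  -- Both sides unfold to ¬ T I 2 (negs m G) V, the left one by clause (4).
  T₁-negs⇔¬T₀-negs dne {suc (suc m)} _ _ V = ⇔-id _

proposition2 : ExcludedMiddle 0ℓ →
    (L : Signature) (I : N4Interp L) (V : Assign I) (F : Formula L) →
    PrefixNegForm F →
    (∀ (k : ℕ) (G : Formula L) → F ≢ negs (suc (2 * k)) G) →
    ¬ (Val I V F ⇔ Val I V (¬' F))
proposition2 em L I V F (n , G , G-negFree , refl) F≢¬²ᵏ⁺¹ F⇔¬F =
  ¬[P⇔¬P] (T₁-negs⇔¬T₀-negs I (em⇒dne em) G-negFree n≢1 V ⇔-∘ F⇔¬F)
  where
  n≢1 : n ≢ 1
  n≢1 refl = F≢¬²ᵏ⁺¹ 0 G refl
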